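{- Let $k\ge3$ and $a\in\mathbb{N}$ with $a\ge1$, and set $B=(a.0)$. Then, as formal power series, \[ C_B^{(k)}(y)=y^a\,G_{k-1}(y). \]
   Context: Words are over the alphabet $\mathbb{N}=\{0,1,2,\dots\}$; $(x.y)$ denotes the length-2 word with letters $x,y$. For $k\ge 2$, $\phi_k$ is the morphism of $\mathbb{N}^*$ defined for $i\in\mathbb{N}$, $0\le j\le k-1$ by $\phi_k(ki+j)=(ki)(ki+j+1)$ if $0\le j\le k-2$ and $\phi_k(ki+k-1)=ki+k$; $W_n^{(k)}=\phi_k^n(0)$. For a nonempty word $B$, $c^{(k)}(B;n)$ is the number of (possibly overlapping) occurrences of $B$ in $W_n^{(k)}$ and $C_B^{(k)}(y)=\sum_{n\ge0}c^{(k)}(B;n)y^n$. For $m\ge2$, the sequence $(g_n^{(m)})_{n\ge0}$ is defined by $g_0^{(m)}=0$, $g_n^{(m)}=2^{n-1}$ for $1\le n\le m-1$, and $g_n^{(m)}=g_{n-1}^{(m)}+\cdots+g_{n-m}^{(m)}$ for $n\ge m$; $G_m(y)=\sum_{n\ge0}g_n^{(m)}y^n$ (equivalently $G_m(y)=(1-y^m)/(1-y-\cdots-y^m)-1$). -}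

module Defs where

open import Data.Nat using (ℕ; zero; suc; _+_; _*_; _∸_; _^_; _<ᵇ_; _≡ᵇ_; _≤ᵇ_)
open import Data.Nat.DivMod using (_/_; _%_)
open import Data.Bool using (Bool; true; false; if_then_else_; _∧_)
open import Data.List using (List; []; _∷_; concatMap; take)
open import Data.Nat.ListAction using (sum)

Word : Set
Word = List ℕ

-- Written for k = suc k′ (so that division
-- by k is defined); the case k = 0 is junk and never used (k ≥ 3 below).
φLetter : ℕ → ℕ → Word
φLetter zero x = x ∷ []
φLetter (suc k′) x =
  let k = suc k′
      i = x / k
      j = x % k
  in if suc j <ᵇ k then (k * i) ∷ (k * i + suc j) ∷ [] else (k * i + k) ∷ []

φ : ℕ → Word → Word
φ k w = concatMap (φLetter k) w

W : ℕ → ℕ → Word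
W k zero = 0 ∷ []
W k (suc n) = φ k (W k n)

isPrefix : Word → Word → Bool
isPrefix [] w = true
isPrefix (b ∷ B) [] = false
isPrefix (b ∷ B) (x ∷ w) = (b ≡ᵇ x) ∧ isPrefix B w

occ : Word → Word → ℕ
occ B [] = if isPrefix B [] then 1 else 0
occ B (x ∷ w) = (if isPrefix B (x ∷ w) then 1 else 0) + occ B w

c : ℕ → Word → ℕ → ℕ
c k B n = occ B (W k n)

-- The sequence g^{(m)}.  gHist m n = [g_n, g_{n-1}, ..., g_0].
-- For n ≥ 1:  g_n = 2^{n-1} if n ≤ m-1 (i.e. n < m), else g_{n-1}+...+g_{n-m}.
gNext : ℕ → ℕ → List ℕ → ℕ
gNext m n hist = if suc n <ᵇ m then 2 ^ n else sum (take m hist)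

gHist : ℕ → ℕ → List ℕ
g : ℕ → ℕ → ℕ
gHist m zero = 0 ∷ []
gHist m (suc n) = g m (suc n) ∷ gHist m n
g m zero = 0
g m (suc n) = gNext m n (gHist m n)

-- Coefficient of y^n in y^a · F(y), where F has coefficient sequence f.
shiftCoeff : ℕ → (ℕ → ℕ) → ℕ → ℕ
shiftCoeff a f n = if a ≤ᵇ n then f (n ∸ a) else 0

{-# OPTIONS --safe #-}
-- Write m = k − 1.  The image φ_k(x) ends with the letter x + 1 and begins with 0 if x < m,
-- with a letter ≥ m otherwise.  Hence a factor (b+1).0 of φ_k(w), and likewise a factor
-- (b+1).y with y < m, can only straddle φ_k(b) φ_k(y′) for a factor b.y′ of w with y′ < m;
-- iterating, c(a.0; n) is the number of factors 0.y, y < m, of W_{n−a}.  Those of W_{j+1}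
-- are the factors 0.(x+1) of φ_k(x) with x + 1 < m.  With P(0) = 1 and
-- P(j+1) = #{letters < m in W_j}, the letter counts below any t ≤ m are window sums of P, so
-- P(j+1) = P(j) + ⋯ + P(j−m+1), i.e. P(y) = 1/(1 − y − ⋯ − y^m), and the count above is
-- P(j+1) − P(j+1−m), the coefficient of y^{j+1} in (1 − y^m) P(y) − 1 = G_m(y).
module Submission where

open import Defs
open import Data.Nat using (ℕ; _≤_; _∸_)
open import Data.List using (_∷_; [])
open import Relation.Binary.PropositionalEquality using (_≡_)

open import Data.Bool using (Bool; true; false; if_then_else_; _∧_; T)
open import Data.Bool.Properties using (∧-identityʳ; ∧-zeroʳ)
open import Data.Empty using (⊥-elim)
open import Data.List using (List; _++_; map; concatMap; take)
open import Data.List.Properties using (++-identityʳ; map-++; map-cong; take-all)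
open import Data.Nat using (zero; suc; _+_; _*_; _^_; _<_; _<ᵇ_; _≡ᵇ_; z≤n; s≤s; s≤s⁻¹; _<?_)
open import Data.Nat.DivMod using (_/_; _%_; m≡m%n+[m/n]*n; m%n<n)
open import Data.Nat.Induction using (<-rec)
open import Data.Nat.ListAction using (sum)
open import Data.Nat.ListAction.Properties using (sum-++)
open import Data.Nat.Properties
open import Algebra.Properties.CommutativeSemigroup +-commutativeSemigroup using (interchange)
open import Data.Product using (_,_)
open import Data.Sum using (inj₁; inj₂)
open import Data.Unit using (tt)
open import Function using (_∘_)
open import Relation.Binary.PropositionalEquality
  using (_≢_; refl; sym; trans; cong; cong₂; subst; module ≡-Reasoning)
open import Relation.Nullary using (yes; no)

open ≡-Reasoning

private
  variable
    A B : Set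

⟦_⟧ : Bool → ℕ
⟦ b ⟧ = if b then 1 else 0

<⇒<ᵇ≡true : ∀ {m n} → m < n → (m <ᵇ n) ≡ true
<⇒<ᵇ≡true {zero} {suc n} _ = refl
<⇒<ᵇ≡true {suc m} {suc n} (s≤s m<n) = <⇒<ᵇ≡true m<n

≥⇒<ᵇ≡false : ∀ {m n} → n ≤ m → (m <ᵇ n) ≡ false
≥⇒<ᵇ≡false {n = zero} _ = refl
≥⇒<ᵇ≡false {suc m} {suc n} (s≤s n≤m) = ≥⇒<ᵇ≡false n≤m

sum-map-zero : (w : List A) → sum (map (λ _ → 0) w) ≡ 0
sum-map-zero [] = refl
sum-map-zero (x ∷ w) = sum-map-zero w

adjacentCount : (A → A → Bool) → List A → ℕ
adjacentCount q [] = 0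
adjacentCount q (x ∷ []) = 0
adjacentCount q (x ∷ y ∷ w) = ⟦ q x y ⟧ + adjacentCount q (y ∷ w)

junction : (A → A → Bool) → List A → List A → Bool
junction q [] v = false
junction q (x ∷ []) [] = false
junction q (x ∷ []) (y ∷ v) = q x y
junction q (x ∷ x′ ∷ u) v = junction q (x′ ∷ u) v

adjacentCount-cong : ∀ {q r : A → A → Bool} → (∀ x y → q x y ≡ r x y) →
                     ∀ w → adjacentCount q w ≡ adjacentCount r w
adjacentCount-cong q≗r [] = refl
adjacentCount-cong q≗r (x ∷ []) = refl
adjacentCount-cong q≗r (x ∷ y ∷ w) =
  cong₂ _+_ (cong ⟦_⟧ (q≗r x y)) (adjacentCount-cong q≗r (y ∷ w))

adjacentCount-false : (w : List A) → adjacentCount (λ _ _ → false) w ≡ 0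
adjacentCount-false [] = refl
adjacentCount-false (x ∷ []) = refl
adjacentCount-false (x ∷ y ∷ w) = adjacentCount-false (y ∷ w)

adjacentCount-++ : ∀ (q : A → A → Bool) u v →
  adjacentCount q (u ++ v) ≡ adjacentCount q u + ⟦ junction q u v ⟧ + adjacentCount q v
adjacentCount-++ q [] v = refl
adjacentCount-++ q (x ∷ []) [] = refl
adjacentCount-++ q (x ∷ []) (y ∷ v) = refl
adjacentCount-++ q (x ∷ x′ ∷ u) v = begin
  ⟦ q x x′ ⟧ + adjacentCount q (x′ ∷ u ++ v)
    ≡⟨ cong (⟦ q x x′ ⟧ +_) (adjacentCount-++ q (x′ ∷ u) v) ⟩
  ⟦ q x x′ ⟧ + (adjacentCount q (x′ ∷ u) + ⟦ junction q (x′ ∷ u) v ⟧ + adjacentCount q v)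
    ≡⟨ +-assoc (⟦ q x x′ ⟧) _ _ ⟨
  ⟦ q x x′ ⟧ + (adjacentCount q (x′ ∷ u) + ⟦ junction q (x′ ∷ u) v ⟧) + adjacentCount q v
    ≡⟨ cong (_+ adjacentCount q v) (+-assoc (⟦ q x x′ ⟧) _ _) ⟨
  ⟦ q x x′ ⟧ + adjacentCount q (x′ ∷ u) + ⟦ junction q (x′ ∷ u) v ⟧ + adjacentCount q v ∎

junction-∷ʳ : ∀ (q : A → A → Bool) u y v v′ → junction q u (y ∷ v) ≡ junction q u (y ∷ v′)
junction-∷ʳ q [] y v v′ = refl
junction-∷ʳ q (x ∷ []) y v v′ = refl
junction-∷ʳ q (x ∷ x′ ∷ u) y v v′ = junction-∷ʳ q (x′ ∷ u) y v v′

junction-++ʳ : ∀ (q : A → A → Bool) u {v} r → v ≢ [] → junction q u (v ++ r) ≡ junction q u v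
junction-++ʳ q u {[]} r v≢[] = ⊥-elim (v≢[] refl)
junction-++ʳ q u {y ∷ v} r _ = junction-∷ʳ q u y (v ++ r) v

adjacentCount-concatMap : ∀ (q : A → A → Bool) (f : B → List A) → (∀ x → f x ≢ []) → ∀ w →
  adjacentCount q (concatMap f w)
    ≡ sum (map (adjacentCount q ∘ f) w) + adjacentCount (λ x y → junction q (f x) (f y)) w
adjacentCount-concatMap q f f≢[] [] = refl
adjacentCount-concatMap q f f≢[] (x ∷ []) = begin
  adjacentCount q (f x ++ [])            ≡⟨ cong (adjacentCount q) (++-identityʳ (f x)) ⟩
  adjacentCount q (f x)                  ≡⟨ +-identityʳ _ ⟨
  adjacentCount q (f x) + 0              ≡⟨ +-identityʳ _ ⟨
  adjacentCount q (f x) + 0 + 0          ∎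
adjacentCount-concatMap q f f≢[] (x ∷ y ∷ w) = begin
  adjacentCount q (f x ++ concatMap f (y ∷ w))
    ≡⟨ adjacentCount-++ q (f x) _ ⟩
  adjacentCount q (f x) + ⟦ junction q (f x) (f y ++ concatMap f w) ⟧ + adjacentCount q (concatMap f (y ∷ w))
    ≡⟨ cong₂ (λ j n → adjacentCount q (f x) + ⟦ j ⟧ + n)
             (junction-++ʳ q (f x) _ (f≢[] y)) (adjacentCount-concatMap q f f≢[] (y ∷ w)) ⟩
  adjacentCount q (f x) + ⟦ r x y ⟧ + (sum (map (adjacentCount q ∘ f) (y ∷ w)) + adjacentCount r (y ∷ w))
    ≡⟨ interchange (adjacentCount q (f x)) ⟦ r x y ⟧ _ (adjacentCount r (y ∷ w)) ⟩
  adjacentCount q (f x) + sum (map (adjacentCount q ∘ f) (y ∷ w)) + (⟦ r x y ⟧ + adjacentCount r (y ∷ w)) ∎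
  where
  r = λ x y → junction q (f x) (f y)

isPair : ℕ → ℕ → ℕ → ℕ → Bool
isPair b b′ x y = (b ≡ᵇ x) ∧ (b′ ≡ᵇ y)

occ-adjacentCount : ∀ b b′ w → occ (b ∷ b′ ∷ []) w ≡ adjacentCount (isPair b b′) w
occ-adjacentCount b b′ [] = refl
occ-adjacentCount b b′ (x ∷ []) = cong (λ β → ⟦ β ⟧ + 0) (∧-zeroʳ (b ≡ᵇ x))
occ-adjacentCount b b′ (x ∷ y ∷ w) =
  cong₂ (λ β n → ⟦ (b ≡ᵇ x) ∧ β ⟧ + n)
        (∧-identityʳ (b′ ≡ᵇ y)) (occ-adjacentCount b b′ (y ∷ w))

countBelow : ℕ → Word → ℕ
countBelow t w = sum (map (λ x → ⟦ x <ᵇ t ⟧) w)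

countBelow-++ : ∀ t u v → countBelow t (u ++ v) ≡ countBelow t u + countBelow t v
countBelow-++ t u v = trans (cong sum (map-++ _ u v)) (sum-++ (map _ u) (map _ v))

shiftCoeff-suc : ∀ a f n → shiftCoeff (suc a) f (suc n) ≡ shiftCoeff a f n
shiftCoeff-suc zero f n = refl
shiftCoeff-suc (suc a) f n = refl

shiftCoeff-below : ∀ {a n} f → n < a → shiftCoeff a f n ≡ 0
shiftCoeff-below {suc a} {zero} f _ = refl
shiftCoeff-below {suc a} {suc n} f (s≤s n<a) = trans (shiftCoeff-suc a f n) (shiftCoeff-below f n<a)

shiftCoeff-+ : ∀ a f d → shiftCoeff a f (a + d) ≡ f d
shiftCoeff-+ zero f d = refl
shiftCoeff-+ (suc a) f d = trans (shiftCoeff-suc a f (a + d)) (shiftCoeff-+ a f d)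

shiftCoeff-self : ∀ a f → shiftCoeff a f a ≡ f 0
shiftCoeff-self zero f = refl
shiftCoeff-self (suc a) f = trans (shiftCoeff-suc a f a) (shiftCoeff-self a f)

windowSum : (ℕ → ℕ) → ℕ → ℕ → ℕ
windowSum f n zero = 0
windowSum f zero (suc t) = f zero
windowSum f (suc n) (suc t) = f (suc n) + windowSum f n t

windowSum-cong : ∀ {f f′} n t → (∀ i → i ≤ n → f i ≡ f′ i) → windowSum f n t ≡ windowSum f′ n t
windowSum-cong n zero f≗f′ = refl
windowSum-cong zero (suc t) f≗f′ = f≗f′ 0 z≤n
windowSum-cong (suc n) (suc t) f≗f′ =
  cong₂ _+_ (f≗f′ (suc n) ≤-refl) (windowSum-cong n t (λ i i≤n → f≗f′ i (m≤n⇒m≤1+n i≤n)))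

windowSum-+ : ∀ f f′ n t → windowSum (λ i → f i + f′ i) n t ≡ windowSum f n t + windowSum f′ n t
windowSum-+ f f′ n zero = refl
windowSum-+ f f′ zero (suc t) = refl
windowSum-+ f f′ (suc n) (suc t) =
  trans (cong (f (suc n) + f′ (suc n) +_) (windowSum-+ f f′ n t))
        (interchange (f (suc n)) (f′ (suc n)) (windowSum f n t) (windowSum f′ n t))

windowSum-snoc : ∀ f n t → windowSum f n (suc t) ≡ windowSum f n t + shiftCoeff t f n
windowSum-snoc f zero zero = refl
windowSum-snoc f zero (suc t) = sym (+-identityʳ (f 0))
windowSum-snoc f (suc n) zero = +-identityʳ (f (suc n))
windowSum-snoc f (suc n) (suc t) = begin
  f (suc n) + windowSum f n (suc t)
    ≡⟨ cong (f (suc n) +_) (windowSum-snoc f n t) ⟩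
  f (suc n) + (windowSum f n t + shiftCoeff t f n)
    ≡⟨ +-assoc (f (suc n)) _ _ ⟨
  f (suc n) + windowSum f n t + shiftCoeff t f n
    ≡⟨ cong (f (suc n) + windowSum f n t +_) (shiftCoeff-suc t f n) ⟨
  f (suc n) + windowSum f n t + shiftCoeff (suc t) f (suc n) ∎

windowSum-shiftCoeff-below : ∀ {a} f n t → n < a → windowSum (shiftCoeff a f) n t ≡ 0
windowSum-shiftCoeff-below f n zero _ = refl
windowSum-shiftCoeff-below f zero (suc t) 0<a = shiftCoeff-below f 0<a
windowSum-shiftCoeff-below f (suc n) (suc t) n<a =
  cong₂ _+_ (shiftCoeff-below f n<a) (windowSum-shiftCoeff-below f n t (<⇒≤ n<a))

windowSum-shiftCoeff : ∀ a f d t → windowSum (shiftCoeff a f) (a + d) t ≡ windowSum f d t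
windowSum-shiftCoeff a f d zero = refl
windowSum-shiftCoeff zero f d (suc t) = refl
windowSum-shiftCoeff (suc a) f zero (suc t) = begin
  shiftCoeff (suc a) f (suc (a + 0)) + windowSum (shiftCoeff (suc a) f) (a + 0) t
    ≡⟨ cong₂ _+_ (trans (shiftCoeff-suc a f (a + 0)) (shiftCoeff-+ a f 0))
                 (windowSum-shiftCoeff-below f (a + 0) t (s≤s (≤-reflexive (+-identityʳ a)))) ⟩
  f 0 + 0 ≡⟨ +-identityʳ (f 0) ⟩
  f 0     ∎
windowSum-shiftCoeff (suc a) f (suc d) (suc t) rewrite +-suc a d =
  cong₂ _+_ (trans (cong (shiftCoeff (suc a) f) (sym (+-suc (suc a) d))) (shiftCoeff-+ (suc a) f (suc d)))
            (windowSum-shiftCoeff (suc a) f d t)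

δ : ℕ → ℕ
δ zero = 1
δ (suc _) = 0

windowSum-δ : ∀ n t → windowSum δ n t ≡ ⟦ n <ᵇ t ⟧
windowSum-δ n zero = refl
windowSum-δ zero (suc t) = refl
windowSum-δ (suc n) (suc t) = windowSum-δ n t

sum-take-gHist : ∀ m n t → sum (take t (gHist m n)) ≡ windowSum (g m) n t
sum-take-gHist m n zero = refl
sum-take-gHist m zero (suc t) = cong sum (take-all t [] z≤n)
sum-take-gHist m (suc n) (suc t) = cong (g m (suc n) +_) (sum-take-gHist m n t)

g-initial : ∀ m n → suc n < m → g m (suc n) ≡ 2 ^ n
g-initial m n lt = cong (λ b → if b then 2 ^ n else sum (take m (gHist m n))) (<⇒<ᵇ≡true lt)

g-recurrence : ∀ m n → m ≤ suc n → g m (suc n) ≡ windowSum (g m) n m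
g-recurrence m n le =
  trans (cong (λ b → if b then 2 ^ n else sum (take m (gHist m n))) (≥⇒<ᵇ≡false le)) (sum-take-gHist m n m)

module Multibonacci (m′ : ℕ) (P : ℕ → ℕ) (P-zero : P 0 ≡ 1)
                    (P-suc : ∀ n → P (suc n) ≡ windowSum P n (suc m′)) where

  private
    m : ℕ
    m = suc m′

  windowSum-initial : ∀ j t → j < t → t ≤ m → windowSum P j t ≡ 2 ^ j
  windowSum-initial zero (suc t) _ _ = P-zero
  windowSum-initial (suc j) (suc t) (s≤s j<t) t<m = begin
    P (suc j) + windowSum P j t        ≡⟨ cong (_+ windowSum P j t) (P-suc j) ⟩
    windowSum P j m + windowSum P j t  ≡⟨ cong₂ _+_ (windowSum-initial j m (<-trans j<t t<m) ≤-refl)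
                                                    (windowSum-initial j t j<t (<⇒≤ t<m)) ⟩
    2 ^ j + 2 ^ j                      ≡⟨ cong (2 ^ j +_) (+-identityʳ (2 ^ j)) ⟨
    2 ^ suc j                          ∎

  windowSum-shiftCoeff-δ : ∀ {j} → m′ ≤ j →
    windowSum (shiftCoeff m P) j m + windowSum δ j m ≡ shiftCoeff m P (suc j)
  windowSum-shiftCoeff-δ m′≤j with m≤n⇒m<n∨m≡n m′≤j
  ... | inj₂ refl = begin
    windowSum (shiftCoeff m P) m′ m + windowSum δ m′ m
      ≡⟨ cong₂ _+_ (windowSum-shiftCoeff-below P m′ m ≤-refl) (windowSum-δ m′ m) ⟩
    ⟦ m′ <ᵇ m ⟧         ≡⟨ cong ⟦_⟧ (<⇒<ᵇ≡true (n<1+n m′)) ⟩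
    1                   ≡⟨ P-zero ⟨
    P 0                 ≡⟨ shiftCoeff-self m P ⟨
    shiftCoeff m P m    ∎
  ... | inj₁ m≤j with m≤n⇒∃[o]m+o≡n m≤j
  ...   | d , refl = begin
    windowSum (shiftCoeff m P) (m + d) m + windowSum δ (m + d) m
      ≡⟨ cong₂ _+_ (windowSum-shiftCoeff m P d m)
                   (trans (windowSum-δ (m + d) m) (cong ⟦_⟧ (≥⇒<ᵇ≡false (m≤m+n m d)))) ⟩
    windowSum P d m + 0           ≡⟨ +-identityʳ _ ⟩
    windowSum P d m               ≡⟨ P-suc d ⟨
    P (suc d)                     ≡⟨ shiftCoeff-+ m P (suc d) ⟨
    shiftCoeff m P (m + suc d)    ≡⟨ cong (shiftCoeff m P) (+-suc m d) ⟩
    shiftCoeff m P (suc (m + d))  ∎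

  -- (1 − y^m) P(y) = 1 + G_m(y), written without subtraction.
  decomposition : ∀ n → P n ≡ g m n + shiftCoeff m P n + δ n
  decomposition = <-rec _ step
    where
    step : ∀ n → (∀ {i} → i < n → P i ≡ g m i + shiftCoeff m P i + δ i) →
           P n ≡ g m n + shiftCoeff m P n + δ n
    step zero _ = P-zero
    step (suc j) IH with suc j <? m
    ... | yes suc-j<m = begin
      P (suc j)                                  ≡⟨ P-suc j ⟩
      windowSum P j m                            ≡⟨ windowSum-initial j m (<⇒≤ suc-j<m) ≤-refl ⟩
      2 ^ j                                      ≡⟨ g-initial m j suc-j<m ⟨
      g m (suc j)                                ≡⟨ +-identityʳ _ ⟨
      g m (suc j) + 0                            ≡⟨ +-identityʳ _ ⟨
      g m (suc j) + 0 + 0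
        ≡⟨ cong (λ s → g m (suc j) + s + 0) (shiftCoeff-below P suc-j<m) ⟨
      g m (suc j) + shiftCoeff m P (suc j) + 0   ∎
    ... | no suc-j≮m = begin
      P (suc j)
        ≡⟨ P-suc j ⟩
      windowSum P j m
        ≡⟨ windowSum-cong j m (λ i i≤j → IH (s≤s i≤j)) ⟩
      windowSum (λ i → g m i + shiftCoeff m P i + δ i) j m
        ≡⟨ windowSum-+ (λ i → g m i + shiftCoeff m P i) δ j m ⟩
      windowSum (λ i → g m i + shiftCoeff m P i) j m + windowSum δ j m
        ≡⟨ cong (_+ windowSum δ j m) (windowSum-+ (g m) (shiftCoeff m P) j m) ⟩
      windowSum (g m) j m + windowSum (shiftCoeff m P) j m + windowSum δ j m
        ≡⟨ +-assoc (windowSum (g m) j m) _ _ ⟩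
      windowSum (g m) j m + (windowSum (shiftCoeff m P) j m + windowSum δ j m)
        ≡⟨ cong₂ _+_ (g-recurrence m j m≤suc-j) (sym (windowSum-shiftCoeff-δ (s≤s⁻¹ m≤suc-j))) ⟨
      g m (suc j) + shiftCoeff m P (suc j)
        ≡⟨ +-identityʳ _ ⟨
      g m (suc j) + shiftCoeff m P (suc j) + 0 ∎
      where
      m≤suc-j : m ≤ suc j
      m≤suc-j = ≮⇒≥ suc-j≮m

  g-window : ∀ n → g m (suc n) ≡ windowSum P n m′
  g-window n = +-cancelʳ-≡ (shiftCoeff m′ P n) _ _ (begin
    g m (suc n) + shiftCoeff m′ P n           ≡⟨ cong (g m (suc n) +_) (shiftCoeff-suc m′ P n) ⟨
    g m (suc n) + shiftCoeff m P (suc n)      ≡⟨ +-identityʳ _ ⟨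
    g m (suc n) + shiftCoeff m P (suc n) + 0  ≡⟨ decomposition (suc n) ⟨
    P (suc n)                                 ≡⟨ P-suc n ⟩
    windowSum P n m                           ≡⟨ windowSum-snoc P n m′ ⟩
    windowSum P n m′ + shiftCoeff m′ P n      ∎)

module _ (m′ : ℕ) where

  private
    m k : ℕ
    m = suc m′
    k = suc m

  -- φ_k(x) for x < m, for x ≥ m with x ≡ m (mod k), and for the remaining x ≥ k (p = k ⌊x / k⌋).
  data Shape (x : ℕ) : Word → Set where
    small : x < m → Shape x (0 ∷ suc x ∷ [])
    carry : m ≤ x → Shape x (suc x ∷ [])
    large : ∀ {p} → m ≤ p → m ≤ x → Shape x (p ∷ suc x ∷ [])

  shape : ∀ x → Shape x (φLetter k x)
  shape x = shape-divMod (x / k) (x % k) (m≡m%n+[m/n]*n x k) (m%n<n x k)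
    where
    last-letter : ∀ i j → x ≡ j + i * k → k * i + suc j ≡ suc x
    last-letter i j x≡ = begin
      k * i + suc j    ≡⟨ +-suc (k * i) j ⟩
      suc (k * i + j)  ≡⟨ cong suc (+-comm (k * i) j) ⟩
      suc (j + k * i)  ≡⟨ cong (λ z → suc (j + z)) (*-comm k i) ⟩
      suc (j + i * k)  ≡⟨ cong suc x≡ ⟨
      suc x            ∎

    shape-divMod : ∀ i j → x ≡ j + i * k → j < k →
      Shape x (if suc j <ᵇ k then k * i ∷ k * i + suc j ∷ [] else k * i + k ∷ [])
    shape-divMod i j x≡ j<k with suc j <ᵇ k in e
    shape-divMod zero j x≡ j<k | true =
      subst (Shape x) (cong₂ (λ a b → a ∷ b ∷ []) (sym (*-zeroʳ k)) (sym (last-letter 0 j x≡)))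
            (small (subst (_< m) (sym (trans x≡ (+-identityʳ j))) (<ᵇ⇒< j m (subst T (sym e) tt))))
    shape-divMod (suc i) j x≡ j<k | true =
      subst (Shape x) (cong (k * suc i ∷_) (cong (_∷ []) (sym (last-letter (suc i) j x≡))))
            (large (≤-trans (n≤1+n m) (m≤m*n k (suc i)))
                   (subst (m ≤_) (sym x≡) (≤-trans (n≤1+n m) (≤-trans (m≤m+n k (i * k)) (m≤n+m _ j)))))
    shape-divMod i j x≡ j<k | false =
      subst (Shape x) (cong (_∷ []) (sym (last-letter i m (trans x≡ (cong (_+ i * k) j≡m)))))
            (carry (subst (m ≤_) (sym x≡) (subst (_≤ j + i * k) j≡m (m≤m+n j (i * k)))))
      where
      j≡m : j ≡ m
      j≡m = ≤-antisym (s≤s⁻¹ j<k) (≮⇒≥ (λ j<m → subst T e (<⇒<ᵇ j<m)))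

  Shape-nonempty : ∀ {x u} → Shape x u → u ≢ []
  Shape-nonempty (small _) ()
  Shape-nonempty (carry _) ()
  Shape-nonempty (large _ _) ()

  φLetter-nonempty : ∀ x → φLetter k x ≢ []
  φLetter-nonempty x = Shape-nonempty (shape x)

  junction-last : ∀ q {x u} v → Shape x u → junction q u v ≡ junction q (suc x ∷ []) v
  junction-last q v (small _) = refl
  junction-last q v (carry _) = refl
  junction-last q v (large _ _) = refl

  followedBySmall : ℕ → ℕ → ℕ → Bool
  followedBySmall b x y = (b ≡ᵇ x) ∧ (y <ᵇ m)

  followedBy-φ : (zeroLike : ℕ → Bool) → zeroLike 0 ≡ true → (∀ {z} → m ≤ z → zeroLike z ≡ false) →
    ∀ b w → adjacentCount (λ x y → (suc b ≡ᵇ x) ∧ zeroLike y) (φ k w)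
              ≡ adjacentCount (followedBySmall b) w
  followedBy-φ zeroLike zeroLike-0 zeroLike-large b w = begin
    adjacentCount q (φ k w)
      ≡⟨ adjacentCount-concatMap q (φLetter k) φLetter-nonempty w ⟩
    sum (map (adjacentCount q ∘ φLetter k) w) + adjacentCount (λ x y → junction q (φLetter k x) (φLetter k y)) w
      ≡⟨ cong₂ _+_ (trans (cong sum (map-cong (λ x → inner (shape x)) w)) (sum-map-zero w))
                   (adjacentCount-cong (λ x y → across (shape x) (shape y)) w) ⟩
    adjacentCount (followedBySmall b) w ∎
    where
    q : ℕ → ℕ → Bool
    q x y = (suc b ≡ᵇ x) ∧ zeroLike y

    inner : ∀ {x u} → Shape x u → adjacentCount q u ≡ 0
    inner (small _) = refl
    inner (carry _) = refl
    inner (large {p} _ m≤x) =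
      cong (λ β → ⟦ β ⟧ + 0)
           (trans (cong ((suc b ≡ᵇ p) ∧_) (zeroLike-large (m≤n⇒m≤1+n m≤x))) (∧-zeroʳ _))

    across : ∀ {x y u v} → Shape x u → Shape y v → junction q u v ≡ followedBySmall b x y
    across {x} {y} {v = v} sx sy = trans (junction-last q v sx) (first sy)
      where
      first : ∀ {v} → Shape y v → junction q (suc x ∷ []) v ≡ followedBySmall b x y
      first (small y<m) =
        cong ((b ≡ᵇ x) ∧_) (trans zeroLike-0 (sym (<⇒<ᵇ≡true y<m)))
      first (carry m≤y) =
        cong ((b ≡ᵇ x) ∧_) (trans (zeroLike-large (m≤n⇒m≤1+n m≤y)) (sym (≥⇒<ᵇ≡false m≤y)))
      first (large m≤p m≤y) =
        cong ((b ≡ᵇ x) ∧_) (trans (zeroLike-large m≤p) (sym (≥⇒<ᵇ≡false m≤y)))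

  followedBySmall-zero-φ : ∀ w → adjacentCount (followedBySmall 0) (φ k w) ≡ countBelow m′ w
  followedBySmall-zero-φ w = begin
    adjacentCount q (φ k w)
      ≡⟨ adjacentCount-concatMap q (φLetter k) φLetter-nonempty w ⟩
    sum (map (adjacentCount q ∘ φLetter k) w) + adjacentCount (λ x y → junction q (φLetter k x) (φLetter k y)) w
      ≡⟨ cong₂ _+_ (cong sum (map-cong (λ x → inner (shape x)) w))
                   (trans (adjacentCount-cong (λ x y → across (shape x) (φLetter k y)) w) (adjacentCount-false w)) ⟩
    countBelow m′ w + 0 ≡⟨ +-identityʳ _ ⟩
    countBelow m′ w     ∎
    where
    q : ℕ → ℕ → Bool
    q = followedBySmall 0

    inner : ∀ {x u} → Shape x u → adjacentCount q u ≡ ⟦ x <ᵇ m′ ⟧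
    inner (small _) = +-identityʳ _
    inner (carry m≤x) = cong ⟦_⟧ (sym (≥⇒<ᵇ≡false (≤-trans (n≤1+n m′) m≤x)))
    inner (large (s≤s _) m≤x) = cong ⟦_⟧ (sym (≥⇒<ᵇ≡false (≤-trans (n≤1+n m′) m≤x)))

    across : ∀ {x u} → Shape x u → ∀ v → junction q u v ≡ false
    across {x} sx v = trans (junction-last q v sx) (first v)
      where
      first : ∀ v → junction q (suc x ∷ []) v ≡ false
      first [] = refl
      first (y ∷ _) = refl

  countBelow-letter : ∀ {t x u} → t < m → Shape x u →
                      countBelow (suc t) u ≡ ⟦ x <ᵇ m ⟧ + ⟦ x <ᵇ t ⟧
  countBelow-letter {t} {x} t<m (small x<m) rewrite <⇒<ᵇ≡true x<m = cong suc (+-identityʳ ⟦ x <ᵇ t ⟧)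
  countBelow-letter t<m (carry m≤x)
    rewrite ≥⇒<ᵇ≡false (≤-trans (<⇒≤ t<m) m≤x) | ≥⇒<ᵇ≡false m≤x = refl
  countBelow-letter t<m (large m≤p m≤x)
    rewrite ≥⇒<ᵇ≡false (≤-trans t<m m≤p)
          | ≥⇒<ᵇ≡false (≤-trans (<⇒≤ t<m) m≤x)
          | ≥⇒<ᵇ≡false m≤x = refl

  countBelow-φ : ∀ {t} → t < m → ∀ w → countBelow (suc t) (φ k w) ≡ countBelow m w + countBelow t w
  countBelow-φ t<m [] = refl
  countBelow-φ {t} t<m (x ∷ w) = begin
    countBelow (suc t) (φLetter k x ++ φ k w)
      ≡⟨ countBelow-++ (suc t) (φLetter k x) (φ k w) ⟩
    countBelow (suc t) (φLetter k x) + countBelow (suc t) (φ k w)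
      ≡⟨ cong₂ _+_ (countBelow-letter t<m (shape x)) (countBelow-φ t<m w) ⟩
    ⟦ x <ᵇ m ⟧ + ⟦ x <ᵇ t ⟧ + (countBelow m w + countBelow t w)
      ≡⟨ interchange ⟦ x <ᵇ m ⟧ ⟦ x <ᵇ t ⟧ (countBelow m w) (countBelow t w) ⟩
    ⟦ x <ᵇ m ⟧ + countBelow m w + (⟦ x <ᵇ t ⟧ + countBelow t w) ∎

  smallCount : ℕ → ℕ
  smallCount zero = 1
  smallCount (suc n) = countBelow m (W k n)

  countBelow-W : ∀ n t → t ≤ m → countBelow t (W k n) ≡ windowSum smallCount n t
  countBelow-W n zero _ = sum-map-zero (W k n)
  countBelow-W zero (suc t) _ = refl
  countBelow-W (suc n) (suc t) t<m =
    trans (countBelow-φ t<m (W k n)) (cong (countBelow m (W k n) +_) (countBelow-W n t (<⇒≤ t<m)))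

  open Multibonacci m′ smallCount refl (λ n → countBelow-W n m ≤-refl) using (g-window)

  followedBySmall-W : ∀ b n → adjacentCount (followedBySmall b) (W k n) ≡ shiftCoeff b (g m) n
  followedBySmall-W zero zero = refl
  followedBySmall-W zero (suc n) = begin
    adjacentCount (followedBySmall 0) (φ k (W k n))  ≡⟨ followedBySmall-zero-φ (W k n) ⟩
    countBelow m′ (W k n)                            ≡⟨ countBelow-W n m′ (n≤1+n m′) ⟩
    windowSum smallCount n m′                        ≡⟨ g-window n ⟨
    g m (suc n)                                      ∎
  followedBySmall-W (suc b) zero = refl
  followedBySmall-W (suc b) (suc n) = begin
    adjacentCount (followedBySmall (suc b)) (φ k (W k n))  ≡⟨ followedBy-φ (_<ᵇ m) refl ≥⇒<ᵇ≡false b (W k n) ⟩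
    adjacentCount (followedBySmall b) (W k n)              ≡⟨ followedBySmall-W b n ⟩
    shiftCoeff b (g m) n                                   ≡⟨ shiftCoeff-suc b (g m) n ⟨
    shiftCoeff (suc b) (g m) (suc n)                       ∎

  occurrences : ∀ b n → c k (suc b ∷ 0 ∷ []) n ≡ shiftCoeff (suc b) (g m) n
  occurrences b zero = refl
  occurrences b (suc n) = begin
    occ (suc b ∷ 0 ∷ []) (φ k (W k n))              ≡⟨ occ-adjacentCount (suc b) 0 (φ k (W k n)) ⟩
    adjacentCount (isPair (suc b) 0) (φ k (W k n))  ≡⟨ followedBy-φ (0 ≡ᵇ_) refl positive b (W k n) ⟩
    adjacentCount (followedBySmall b) (W k n)       ≡⟨ followedBySmall-W b n ⟩
    shiftCoeff b (g m) n                            ≡⟨ shiftCoeff-suc b (g m) n ⟨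
    shiftCoeff (suc b) (g m) (suc n)                ∎
    where
    positive : ∀ {z} → m ≤ z → (0 ≡ᵇ z) ≡ false
    positive (s≤s _) = refl

theorem5p9 : (k a : ℕ) → 3 ≤ k → 1 ≤ a →
    (n : ℕ) → c k (a ∷ 0 ∷ []) n ≡ shiftCoeff a (g (k ∸ 1)) n
theorem5p9 (suc (suc m′)) (suc b) _ _ n = occurrences m′ b n
theorem5p9 (suc zero) _ (s≤s ()) _ _
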